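{- Let $G=(V\cup\{s,t\},E)$ be an undirected graph with non-negative edge weights $w_{u,v}$, and let $n=|V|$. Let $\mathit{OPT}$ be the optimal value of the Minimum Shared-Power Edge Cut problem on $G$, and let $p^*$ be the optimal value of the Minimum Bottleneck Shared-Power Edge Cut problem on $G$. Then $p^*\le \mathit{OPT}\le n p^*$.
   Context: Minimum Shared-Power Edge Cut (MSPEC): assign a non-negative power $p_v$ to each $v\in V$, with $p_s=p_t=0$, such that removing the edge set $\{(u,v)\in E: p_u+p_v\ge w_{u,v}\}$ disconnects $s$ and $t$, minimizing $\sum_{v\in V}p_v$. Minimum Bottleneck Shared-Power Edge Cut: find the minimum $p\ge 0$ such that $s$ and $t$ become disconnected after removing every edge $(u,v)$ with $u,v\in V$ and $2p\ge w_{u,v}$, and every edge $(u,v)$ with $u\in V$, $v\in\{s,t\}$ and $p\ge w_{u,v}$.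
   Formalization: The edge weights $w_{u,v}$, the powers $p_v$ and $p$, and hence the optimal values $\mathit{OPT}$ and $p^*$ are rational. -}

module Defs where

open import Data.Nat using (ℕ)
open import Data.Fin using (Fin; zero; suc)
open import Data.Integer using (+_)
open import Data.Rational using (ℚ; 0ℚ; _+_; _*_; _/_; _≤_)
open import Data.Product using (_×_; Σ)
open import Relation.Binary.PropositionalEquality using (_≡_)
open import Relation.Nullary using (¬_)
open import Data.Empty using (⊥)

data Vtx (n : ℕ) : Set where
  inV : Fin n → Vtx n
  s   : Vtx n
  t   : Vtx n

record Graph (n : ℕ) : Set₁ where
  field
    E       : Vtx n → Vtx n → Set
    E-sym   : ∀ {u v} → E u v → E v u
    E-irr   : ∀ {u} → ¬ E u u
    w       : Vtx n → Vtx n → ℚ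
    w-sym   : ∀ u v → w u v ≡ w v u
    w-nonneg : ∀ u v → E u v → 0ℚ ≤ w u v
open Graph public

data Reach {n : ℕ} (G : Graph n) (keep : Vtx n → Vtx n → Set) : Vtx n → Vtx n → Set where
  here : ∀ {u} → Reach G keep u u
  step : ∀ {u v x} → E G u v → keep u v → Reach G keep v x → Reach G keep u x

Disconnects : ∀ {n} → Graph n → (Vtx n → Vtx n → Set) → Set
Disconnects G keep = ¬ Reach G keep s t

sumFin : ∀ {n} → (Fin n → ℚ) → ℚ
sumFin {ℕ.zero}  f = 0ℚ
sumFin {ℕ.suc n} f = f zero + sumFin (λ i → f (suc i))

record PowerAssignment (n : ℕ) : Set where
  field
    pw       : Vtx n → ℚ
    pw-nonneg : ∀ v → 0ℚ ≤ pw v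
    pw-s     : pw s ≡ 0ℚ
    pw-t     : pw t ≡ 0ℚ
open PowerAssignment public

keptMSPEC : ∀ {n} → Graph n → PowerAssignment n → Vtx n → Vtx n → Set
keptMSPEC G p u v = ¬ (w G u v ≤ pw p u + pw p v)

FeasibleMSPEC : ∀ {n} → Graph n → PowerAssignment n → Set
FeasibleMSPEC G p = Disconnects G (keptMSPEC G p)

cost : ∀ {n} → PowerAssignment n → ℚ
cost p = sumFin (λ i → pw p (inV i))

IsOptMSPEC : ∀ {n} → Graph n → ℚ → Set
IsOptMSPEC G OPT =
  Σ (PowerAssignment _) (λ p → FeasibleMSPEC G p × cost p ≡ OPT)
  × (∀ p → FeasibleMSPEC G p → OPT ≤ cost p)

removedB : ∀ {n} → Graph n → ℚ → Vtx n → Vtx n → Set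
removedB G p (inV i) (inV j) = w G (inV i) (inV j) ≤ (+ 2 / 1) * p
removedB G p (inV i) v       = w G (inV i) v ≤ p
removedB G p u       (inV j) = w G u (inV j) ≤ p
removedB G p u       v       = ⊥

keptB : ∀ {n} → Graph n → ℚ → Vtx n → Vtx n → Set
keptB G p u v = ¬ removedB G p u v

FeasibleB : ∀ {n} → Graph n → ℚ → Set
FeasibleB G p = 0ℚ ≤ p × Disconnects G (keptB G p)

IsOptB : ∀ {n} → Graph n → ℚ → Set
IsOptB G p* = FeasibleB G p* × (∀ p → FeasibleB G p → p* ≤ p)

-- A feasible power assignment p of cost c removes every edge the bottleneck
-- problem removes at level c, since every vertex power is at most c; hence p* ≤ OPT.
-- (An s–t edge, never removed by the bottleneck problem, cannot exist because p* is feasible.)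
-- Conversely, giving every vertex of V the power p* removes every edge the
-- bottleneck problem removes at p*, and this assignment costs n p*; hence OPT ≤ n p*.
module Submission where

open import Defs
open import Data.Nat using (ℕ)
open import Data.Integer using (+_)
open import Data.Rational using (ℚ; _*_; _/_; _≤_)
open import Data.Product using (_×_)

import Data.Nat as ℕ
import Data.Integer as ℤ
import Data.Integer.Properties as ℤ
import Data.Nat.Coprimality as Coprimality
import Data.Rational.Unnormalised.Base as ℚᵘ
import Data.Rational.Unnormalised.Properties as ℚᵘ
open import Data.Rational using (0ℚ; 1ℚ; _+_; mkℚ; toℚᵘ)
open import Data.Rational.Properties
open import Data.Fin using (Fin; zero; suc)
open import Data.Product using (_,_; proj₁)
open import Data.Empty using (⊥-elim)
open import Relation.Nullary using (¬_)
open import Relation.Binary.PropositionalEquality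

m-coprimeTo-1 : ∀ m → Coprimality.Coprime m 1
m-coprimeTo-1 m = Coprimality.sym (Coprimality.1-coprimeTo m)

+m/1≡mkℚ : ∀ m → + m / 1 ≡ mkℚ (+ m) 0 (m-coprimeTo-1 m)
+m/1≡mkℚ m = normalize-coprime (m-coprimeTo-1 m)

+[1+m]/1≡1+m/1 : ∀ m → + ℕ.suc m / 1 ≡ 1ℚ + + m / 1
+[1+m]/1≡1+m/1 m rewrite +m/1≡mkℚ (ℕ.suc m) | +m/1≡mkℚ m =
  toℚᵘ-injective (ℚᵘ.≃-trans (ℚᵘ.*≡* numerators) (ℚᵘ.≃-sym (toℚᵘ-homo-+ 1ℚ (mkℚ (+ m) 0 (m-coprimeTo-1 m)))))
  where
  open ≡-Reasoning
  numerators : + ℕ.suc m ℤ.* + 1 ≡ (+ 1 ℤ.+ + m ℤ.* + 1) ℤ.* + 1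
  numerators = begin
    + ℕ.suc m ℤ.* + 1              ≡⟨ ℤ.*-identityʳ _ ⟩
    + 1 ℤ.+ + m                    ≡⟨ cong (ℤ._+_ (+ 1)) (sym (ℤ.*-identityʳ (+ m))) ⟩
    + 1 ℤ.+ + m ℤ.* + 1            ≡⟨ sym (ℤ.*-identityʳ _) ⟩
    (+ 1 ℤ.+ + m ℤ.* + 1) ℤ.* + 1  ∎

p+p≡2*p : ∀ p → p + p ≡ (+ 2 / 1) * p
p+p≡2*p p = begin
  p + p            ≡⟨ sym (cong₂ _+_ (*-identityˡ p) (*-identityˡ p)) ⟩
  1ℚ * p + 1ℚ * p  ≡⟨ sym (*-distribʳ-+ p 1ℚ 1ℚ) ⟩
  (+ 2 / 1) * p    ∎
  where open ≡-Reasoning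

p≤r∧q≡0⇒p+q≤r : ∀ {p q r} → p ≤ r → q ≡ 0ℚ → p + q ≤ r
p≤r∧q≡0⇒p+q≤r {p} p≤r refl = ≤-trans (≤-reflexive (+-identityʳ p)) p≤r

q≤r∧p≡0⇒p+q≤r : ∀ {p q r} → q ≤ r → p ≡ 0ℚ → p + q ≤ r
q≤r∧p≡0⇒p+q≤r {q = q} q≤r refl = ≤-trans (≤-reflexive (+-identityˡ q)) q≤r

sumFin-const : ∀ n c → sumFin {n} (λ _ → c) ≡ (+ n / 1) * c
sumFin-const ℕ.zero    c = sym (*-zeroˡ c)
sumFin-const (ℕ.suc n) c = begin
  c + sumFin {n} (λ _ → c)  ≡⟨ cong₂ _+_ (sym (*-identityˡ c)) (sumFin-const n c) ⟩
  1ℚ * c + (+ n / 1) * c    ≡⟨ sym (*-distribʳ-+ c 1ℚ (+ n / 1)) ⟩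
  (1ℚ + + n / 1) * c        ≡⟨ cong (_* c) (sym (+[1+m]/1≡1+m/1 n)) ⟩
  (+ ℕ.suc n / 1) * c       ∎
  where open ≡-Reasoning

sumFin-nonNeg : ∀ {n} (f : Fin n → ℚ) → (∀ i → 0ℚ ≤ f i) → 0ℚ ≤ sumFin f
sumFin-nonNeg {ℕ.zero}  f f≥0 = ≤-refl
sumFin-nonNeg {ℕ.suc n} f f≥0 =
  q≤r∧p≡0⇒p+q≤r (+-mono-≤ (f≥0 zero) (sumFin-nonNeg (λ i → f (suc i)) (λ i → f≥0 (suc i)))) refl

term≤sumFin : ∀ {n} (f : Fin n → ℚ) → (∀ i → 0ℚ ≤ f i) → ∀ i → f i ≤ sumFin f
term≤sumFin f f≥0 zero =
  ≤-trans (≤-reflexive (sym (+-identityʳ (f zero))))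
          (+-mono-≤ (≤-refl {f zero}) (sumFin-nonNeg (λ i → f (suc i)) (λ i → f≥0 (suc i))))
term≤sumFin f f≥0 (suc j) =
  ≤-trans (≤-reflexive (sym (+-identityˡ (f (suc j)))))
          (+-mono-≤ (f≥0 zero) (term≤sumFin (λ i → f (suc i)) (λ i → f≥0 (suc i)) j))

Reach-mono : ∀ {n} {G : Graph n} {keep keep′ : Vtx n → Vtx n → Set} →
             (∀ {u v} → E G u v → keep u v → keep′ u v) →
             ∀ {u v} → Reach G keep u v → Reach G keep′ u v
Reach-mono keep⇒keep′ here            = here
Reach-mono keep⇒keep′ (step e kept r) = step e (keep⇒keep′ e kept) (Reach-mono keep⇒keep′ r)

Disconnects-mono : ∀ {n} {G : Graph n} {keep keep′ : Vtx n → Vtx n → Set} →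
                   (∀ {u v} → E G u v → keep′ u v → keep u v) →
                   Disconnects G keep → Disconnects G keep′
Disconnects-mono keep′⇒keep cut r = cut (Reach-mono keep′⇒keep r)

feasibleB⇒¬E-s-t : ∀ {n} {G : Graph n} {p} → FeasibleB G p → ¬ E G s t
feasibleB⇒¬E-s-t (_ , cut) e = cut (step e (λ ()) here)

power≤cost : ∀ {n} (p : PowerAssignment n) i → pw p (inV i) ≤ cost p
power≤cost p = term≤sumFin (λ i → pw p (inV i)) (λ i → pw-nonneg p (inV i))

cost-nonNeg : ∀ {n} (p : PowerAssignment n) → 0ℚ ≤ cost p
cost-nonNeg p = sumFin-nonNeg (λ i → pw p (inV i)) (λ i → pw-nonneg p (inV i))

removedMSPEC⇒removedB-cost : ∀ {n} (G : Graph n) (p : PowerAssignment n) →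
  ¬ E G s t → ∀ {u v} → E G u v → w G u v ≤ pw p u + pw p v → removedB G (cost p) u v
removedMSPEC⇒removedB-cost G p ¬st {inV i} {inV j} e w≤ =
  ≤-trans w≤ (≤-trans (+-mono-≤ (power≤cost p i) (power≤cost p j)) (≤-reflexive (p+p≡2*p (cost p))))
removedMSPEC⇒removedB-cost G p ¬st {inV i} {s} e w≤ = ≤-trans w≤ (p≤r∧q≡0⇒p+q≤r (power≤cost p i) (pw-s p))
removedMSPEC⇒removedB-cost G p ¬st {inV i} {t} e w≤ = ≤-trans w≤ (p≤r∧q≡0⇒p+q≤r (power≤cost p i) (pw-t p))
removedMSPEC⇒removedB-cost G p ¬st {s} {inV j} e w≤ = ≤-trans w≤ (q≤r∧p≡0⇒p+q≤r (power≤cost p j) (pw-s p))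
removedMSPEC⇒removedB-cost G p ¬st {t} {inV j} e w≤ = ≤-trans w≤ (q≤r∧p≡0⇒p+q≤r (power≤cost p j) (pw-t p))
removedMSPEC⇒removedB-cost G p ¬st {s} {s} e w≤ = ⊥-elim (E-irr G e)
removedMSPEC⇒removedB-cost G p ¬st {t} {t} e w≤ = ⊥-elim (E-irr G e)
removedMSPEC⇒removedB-cost G p ¬st {s} {t} e w≤ = ⊥-elim (¬st e)
removedMSPEC⇒removedB-cost G p ¬st {t} {s} e w≤ = ⊥-elim (¬st (E-sym G e))

feasibleMSPEC⇒feasibleB-cost : ∀ {n} (G : Graph n) (p : PowerAssignment n) →
  ¬ E G s t → FeasibleMSPEC G p → FeasibleB G (cost p)
feasibleMSPEC⇒feasibleB-cost G p ¬st cut =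
  cost-nonNeg p , Disconnects-mono (λ e keptB w≤ → keptB (removedMSPEC⇒removedB-cost G p ¬st e w≤)) cut

uniformPower : ∀ {n} (q : ℚ) → 0ℚ ≤ q → PowerAssignment n
uniformPower q q≥0 = record
  { pw        = power
  ; pw-nonneg = power-nonNeg
  ; pw-s      = refl
  ; pw-t      = refl
  }
  where
  power : Vtx _ → ℚ
  power (inV _) = q
  power s       = 0ℚ
  power t       = 0ℚ

  power-nonNeg : ∀ v → 0ℚ ≤ power v
  power-nonNeg (inV _) = q≥0
  power-nonNeg s       = ≤-refl
  power-nonNeg t       = ≤-refl

cost-uniformPower : ∀ n q (q≥0 : 0ℚ ≤ q) → cost (uniformPower {n} q q≥0) ≡ (+ n / 1) * q
cost-uniformPower n q _ = sumFin-const n q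

removedB⇒removedMSPEC-uniform : ∀ {n} (G : Graph n) q (q≥0 : 0ℚ ≤ q) → ∀ u v →
  removedB G q u v → w G u v ≤ pw (uniformPower q q≥0) u + pw (uniformPower q q≥0) v
removedB⇒removedMSPEC-uniform G q _ (inV i) (inV j) w≤ = ≤-trans w≤ (≤-reflexive (sym (p+p≡2*p q)))
removedB⇒removedMSPEC-uniform G q _ (inV i) s       w≤ = ≤-trans w≤ (≤-reflexive (sym (+-identityʳ q)))
removedB⇒removedMSPEC-uniform G q _ (inV i) t       w≤ = ≤-trans w≤ (≤-reflexive (sym (+-identityʳ q)))
removedB⇒removedMSPEC-uniform G q _ s       (inV j) w≤ = ≤-trans w≤ (≤-reflexive (sym (+-identityˡ q)))
removedB⇒removedMSPEC-uniform G q _ t       (inV j) w≤ = ≤-trans w≤ (≤-reflexive (sym (+-identityˡ q)))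
removedB⇒removedMSPEC-uniform G q _ s       s       ()
removedB⇒removedMSPEC-uniform G q _ s       t       ()
removedB⇒removedMSPEC-uniform G q _ t       s       ()
removedB⇒removedMSPEC-uniform G q _ t       t       ()

feasibleB⇒feasibleMSPEC-uniform : ∀ {n} (G : Graph n) q (feasible : FeasibleB G q) →
  FeasibleMSPEC G (uniformPower q (proj₁ feasible))
feasibleB⇒feasibleMSPEC-uniform G q (q≥0 , cut) =
  Disconnects-mono (λ {u} {v} _ keptM removed → keptM (removedB⇒removedMSPEC-uniform G q q≥0 u v removed)) cut

lemma1 : (n : ℕ) (G : Graph n) (OPT p* : ℚ) →
    IsOptMSPEC G OPT → IsOptB G p* →
    (p* ≤ OPT) × (OPT ≤ (+ n / 1) * p*)
lemma1 n G OPT p* ((p , feasible , cost≡OPT) , OPT-min) (p*-feasible@(p*≥0 , _) , p*-min) =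
  lower , upper
  where
  lower : p* ≤ OPT
  lower = subst (p* ≤_) cost≡OPT
    (p*-min (cost p) (feasibleMSPEC⇒feasibleB-cost G p (feasibleB⇒¬E-s-t p*-feasible) feasible))

  upper : OPT ≤ (+ n / 1) * p*
  upper = ≤-trans (OPT-min (uniformPower p* p*≥0) (feasibleB⇒feasibleMSPEC-uniform G p* p*-feasible))
                  (≤-reflexive (cost-uniformPower n p* p*≥0))
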